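{- Let $(M_k)_{k<l}$ be an acceptable chain, let $k < l$ and let $m \in M_k$. Then (all closures computed in $M_k$): (i) there is a finite $A_0 \subseteq A$ with $G_{A_0} \subseteq G_m$; (ii) if $m \in S^- \setminus S$, there is a finite $C \subseteq V_p$ with $m^- \cap V_p = C^- \cap V_p$; (iii) if $m \notin (R \cup T)^+$, then $m^+ \cap S \in \Sigma' \cup \{S\}$; (iv) if $m \notin S$, then $m^- \cap S \in \Sigma \cup \{\varnothing\}$; (v) if $m \in S^+$, then every $n \in G\cdot m$ with $n \ne m$ is incomparable to $m$; (vi) if $m \in S^+$, then for every $n \in M_k \setminus (G \cdot m)$ we have $m^- \cap S \neq n^- \cap S$. Moreover, for each $k<l$ the set $\{m^- \cap S : m \in M_k \setminus S\}$ is finite.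
   Context: Notation: for a poset $P$ and $Q\subseteq P$, $Q^- = \{v\in P : \exists w \in Q, v \le w\}$, $Q^+ = \{v \in P : \exists w \in Q, v \ge w\}$, $v^{\pm} = \{v\}^{\pm}$; "$x \perp y$" means $x,y$ incomparable. For $U, W \subseteq P$, $U < W$ means $u<w$ for all $u\in U$, $w \in W$. For a poset $B$, an external type over $B$ is the type over $B$ of the new point $e$ of a one-point extension $B \cup \{e\}$, identified with the partition $(U_r,V_r,W_r)$ of $B$ ($U_r = \{b : b<e\}$, $V_r = \{b : b \perp e\}$, $W_r = \{b : b>e\}$); a partition $(U,V,W)$ of $B$ arises so (a valid triple) iff $U<W$, no $u\in U$ is $>$ some $v \in V$, and no $w\in W$ is $<$ some $v\in V$. If a group acts on $B$ by automorphisms it acts on types by $g\cdot r = (gU_r, gV_r, gW_r)$; $G_x$ denotes the stabiliser of $x$ (a point or a type) and $G_Q$ the pointwise stabiliser of a set $Q$. Setting. $A$ is a countably infinite poset, $G = \mathrm{Aut}(A)$. Topologise external types over $A$ by basic open sets $\{r : U_0\subseteq U_r, V_0 \subseteq V_r, W_0\subseteq W_r\}$, $(U_0,V_0,W_0)$ an external type over a finite subset of $A$; write $r \ll r'$ if $r \ne r'$ and there is a poset $A\cup\{b,c\}$ extending $A$ ($b \neq c$ new) with $b$ of type $r$, $c$ of type $r'$, $b<c$; $\lambda(A) = \{r : U_r = \varnothing\}$. Fix $p \in \lambda(A)$ which is fixed by $G$ and is an upper limit of $\lambda(A)$ (every open set containing $p$ contains some $r\in\lambda(A)$ with $r \ll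 p$). Let $q$ be the external type over $A$ with $(U_q,V_q,W_q) = (V_p, W_p, \varnothing)$. $M_0 = A \cup R\cup S\cup T$ (disjoint) where $R = \{r_i : i<\omega\}$, $S = \{s_j : j<\omega\}$, $T = \{t_a : a \in V_p\}$ are antichains and: each element of $R$ has type $p$ over $A$; each element of $S$ has type $q$ over $A$; $r_i < s_j$ if $i\ge j$ and $r_i \perp s_j$ if $i<j$; $t_a > v$ for all $v\in V_p$ with $v \le a$, and $t_a$ is incomparable to all other points of $M_0$. $G$ acts on $M_0$ extending its action on $A$, fixing $R\cup S$ pointwise, with $g t_a = t_{ga}$. $\Sigma, \Sigma'$ are fixed infinite sets of moieties of $S$ (subsets $Z$ with $Z$ and $S\setminus Z$ infinite) with: (i) for finite $\mathcal U,\mathcal W\subseteq\Sigma$, finite $\mathcal V\subseteq\Sigma'$, finite $C,D\subseteq S$ with $C\cup\bigcup\mathcal U\subseteq\bigcap\mathcal W$ and $(C\cup\bigcup\mathcal U)\cap(D\cup\bigcup\mathcal V)=\varnothing$, there is $Z\in\Sigma$ with $C\cup\bigcup\mathcal U\subseteq Z\subseteq\bigcap\mathcal W$ and $Z\cap(D\cup\bigcup\mathcal V)=\varnothing$, infinitely many such $Z$ if $\mathcal U\cap\mathcal W=\varnothing$; (ii) the same with the roles of $\Sigma,\Sigma'$ swapped and the conditions $C\cup\bigcup\mathcal W\subseteq\bigcap\mathcal U$, $(C\cup\bigcup\mathcal W)\cap(D\cup\bigcup\mathcal V)=\varnothing$, conclusion $C\cup\bigcup\mathcal W\subseteq Z\subseteq\bigcap\mathcal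 U$, $Z\cap(D\cup\bigcup\mathcal V)=\varnothing$ (with $\bigcap\varnothing = S$). A $G$-poset is a poset with a $G$-action by automorphisms. Let $B$ be a countable $G$-poset containing $M_0$ as a $G$-subposet. A pair $(U,W)$ of subsets of $B$ is acceptable if (closures in $B$): (AC1) $U<W$; (AC2) $U\setminus S$ and $W\setminus S$ are finite; (AC3) if $U^-\cap S\ne\varnothing$ then $U^-\cap S\in\Sigma$ and $U^-\cap S\ne m^-\cap S$ for all $m\in B$; (AC4) if $U^-\cap(R\cup T)=\varnothing$ then $W^+\cap S\in\Sigma'\cup\{S\}$. Then $\tau_B(U,W)$ is the external type over $B$ with triple $(U^-, B\setminus(U^-\cup W^+), W^+)$. $B * (U,W)$ is the $G$-poset obtained from $B$ by adding a new point $e_r$ for each type $r$ in the (countable) $G$-orbit of $\tau_B(U,W)$, with $e_r$ of type $r$ over $B$, $e_r < e_{r'}$ iff there is $m\in B$ with $e_r<m<e_{r'}$ (new points otherwise incomparable), and $g e_r = e_{g\cdot r}$. An acceptable chain is a sequence $(M_k)_{k<l}$, $l\in\mathbb N\cup\{\omega\}$, starting with the $G$-poset $M_0$ above, such that for each $1 \le k < l$, $M_k = M_{k-1}*(U,W)$ for some acceptable pair $(U,W)$ of subsets of $M_{k-1}$. -}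

module Defs where

open import Level using (0ℓ) renaming (suc to lsuc)
open import Data.Nat using (ℕ)
import Data.Nat as N
open import Data.Product using (Σ; Σ-syntax; ∃; ∃-syntax; _×_; _,_; proj₁)
open import Data.Sum using (_⊎_)
open import Data.Empty using (⊥)
open import Data.Bool using (Bool; true; false)
open import Data.List using (List)
open import Data.List.Membership.Propositional using (_∈_)
open import Data.List.Relation.Unary.All using (All)
open import Data.List.Relation.Unary.Any using (Any)
open import Relation.Nullary using (¬_)
open import Relation.Binary.PropositionalEquality using (_≡_; trans)
open import Relation.Binary.Structures using (IsStrictPartialOrder)
open import Function.Bundles using (_↔_; _⇔_)

-- Subsets of S = {s_j : j < ω}, identified with subsets of ℕ (index j),
-- and families (sets) of such subsets.

SubS : Set₁
SubS = ℕ → Set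

_≐_ : SubS → SubS → Set
Z ≐ Y = ∀ j → Z j ⇔ Y j

Family : Set₁
Family = SubS → Set

_∈Fam_ : SubS → Family → Set₁
Y ∈Fam F = Σ[ Z ∈ SubS ] (F Z × (Z ≐ Y))

Infinite : SubS → Set
Infinite Z = ∀ n → ∃[ m ] (n N.≤ m × Z m)

Moiety : SubS → Set
Moiety Z = Infinite Z × Infinite (λ j → ¬ Z j)

InfiniteFam : Family → Set₁
InfiniteFam F = (L : List SubS) → Σ[ Z ∈ SubS ] (F Z × All (λ Y → ¬ (Z ≐ Y)) L)

Mem : Family → Set₁
Mem F = Σ[ Z ∈ SubS ] F Z

⋃ : {F : Family} → List (Mem F) → ℕ → Set₁
⋃ 𝒰 j = Any (λ Z → proj₁ Z j) 𝒰

⋂ : {F : Family} → List (Mem F) → ℕ → Set₁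
⋂ 𝒲 j = All (λ Z → proj₁ Z j) 𝒲

-- Property (i) of (Σ , Σ'); property (ii) is  ExtProp Σ' Σ  (after renaming
-- 𝒰 ↔ 𝒲, which is exactly the stated swap of roles).
ExtProp : Family → Family → Set₁
ExtProp F G =
  (𝒰 𝒲 : List (Mem F)) (𝒱 : List (Mem G)) (C D : List ℕ) →
  let lower : ℕ → Set₁
      lower j = j ∈ C ⊎ ⋃ 𝒰 j
      upper : ℕ → Set₁
      upper j = j ∈ D ⊎ ⋃ 𝒱 j
      Good : SubS → Set₁
      Good Z = (∀ j → lower j → Z j) × (∀ j → Z j → ⋂ 𝒲 j)
               × (∀ j → Z j → upper j → ⊥)
  in (∀ j → lower j → ⋂ 𝒲 j) →
     (∀ j → lower j → upper j → ⊥) →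
     (Σ[ Z ∈ SubS ] (F Z × Good Z))
     × ((¬ (Any (λ U → Any (λ W → proj₁ U ≐ proj₁ W) 𝒲) 𝒰)) →
        (L : List SubS) →
        Σ[ Z ∈ SubS ] (F Z × Good Z × All (λ Y → ¬ (Z ≐ Y)) L))

-- External types over A as partitions A = U ⊔ V ⊔ W, encoded as a
-- labelling of A by lo (∈ U, below e), inc (∈ V) , hi (∈ W, above e).

data Pos : Set where
  lo inc hi : Pos

module OverPoset {A : Set} (_<A_ : A → A → Set) where

  _≤A_ : A → A → Set
  a ≤A b = a ≡ b ⊎ a <A b

  ExtType : Set
  ExtType = A → Pos

  Valid : ExtType → Set
  Valid r = (∀ u w → r u ≡ lo → r w ≡ hi → u <A w)
          × (∀ u v → r u ≡ lo → r v ≡ inc → ¬ (v <A u))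
          × (∀ w v → r w ≡ hi → r v ≡ inc → ¬ (w <A v))

  record Aut : Set where
    field
      to   : A → A
      from : A → A
      to-from : ∀ a → to (from a) ≡ a
      from-to : ∀ a → from (to a) ≡ a
      to-mono : ∀ a b → a <A b ⇔ to a <A to b
  open Aut public

  _·_ : Aut → ExtType → ExtType
  (g · r) a = r (from g a)

  InLambda : ExtType → Set
  InLambda r = Valid r × (∀ a → ¬ (r a ≡ lo))

  -- basic open set given by a finite labelled subset of A
  InBasic : List (A × Pos) → ExtType → Set
  InBasic L r = All (λ ax → r (Data.Product.proj₁ ax) ≡ Data.Product.proj₂ ax) L

  -- one-point-each type realisation in a two-point extension A ∪ {b , c}
  -- b = inj₂ false , c = inj₂ true
  HasTypeIn : (_⊏_ : (A ⊎ Bool) → (A ⊎ Bool) → Set) → Bool → ExtType → Set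
  HasTypeIn _⊏_ x r = ∀ a → (Data.Sum.inj₁ a ⊏ Data.Sum.inj₂ x ⇔ r a ≡ lo)
                          × (Data.Sum.inj₂ x ⊏ Data.Sum.inj₁ a ⇔ r a ≡ hi)

  _≪_ : ExtType → ExtType → Set₁
  r ≪ r' = ¬ (∀ a → r a ≡ r' a)
         × Σ[ _⊏_ ∈ ((A ⊎ Bool) → (A ⊎ Bool) → Set) ]
             ( IsStrictPartialOrder _≡_ _⊏_
             × (∀ a a' → Data.Sum.inj₁ a ⊏ Data.Sum.inj₁ a' ⇔ a <A a')
             × HasTypeIn _⊏_ false r × HasTypeIn _⊏_ true r'
             × (Data.Sum.inj₂ false ⊏ Data.Sum.inj₂ true))

  UpperLimit : ExtType → Set₁
  UpperLimit p = (L : List (A × Pos)) → InBasic L p →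
                 Σ[ r ∈ ExtType ] (InLambda r × InBasic L r × r ≪ p)

record Setting : Set₂ where
  field
    A    : Set
    _<A_ : A → A → Set
    A-spo : IsStrictPartialOrder _≡_ _<A_
    A-countably-infinite : A ↔ ℕ
  open OverPoset _<A_ public
  field
    p : ExtType
    p-lambda : InLambda p
    p-fixed : ∀ (g : Aut) a → (g · p) a ≡ p a
    p-upper : UpperLimit p
    Σ₁ Σ₂ : Family
    Σ₁-moieties : ∀ Z → Σ₁ Z → Moiety Z
    Σ₂-moieties : ∀ Z → Σ₂ Z → Moiety Z
    Σ₁-infinite : InfiniteFam Σ₁
    Σ₂-infinite : InfiniteFam Σ₂
    prop-i  : ExtProp Σ₁ Σ₂
    prop-ii : ExtProp Σ₂ Σ₁

  p-fixed' : ∀ (g : Aut) a → p (to g a) ≡ p a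
  p-fixed' g a = trans (Relation.Binary.PropositionalEquality.sym (p-fixed g (to g a)))
                       (Relation.Binary.PropositionalEquality.cong p (from-to g a))

  idAut : Aut
  idAut = record { to = λ a → a ; from = λ a → a
                 ; to-from = λ _ → Relation.Binary.PropositionalEquality.refl
                 ; from-to = λ _ → Relation.Binary.PropositionalEquality.refl
                 ; to-mono = λ a b → Function.Bundles.mk⇔ (λ z → z) (λ z → z) }

  _∘A_ : Aut → Aut → Aut
  g ∘A h = record
    { to = λ a → to g (to h a) ; from = λ a → from h (from g a)
    ; to-from = λ a → trans (Relation.Binary.PropositionalEquality.cong (to g) (to-from h (from g a))) (to-from g a)
    ; from-to = λ a → trans (Relation.Binary.PropositionalEquality.cong (from h) (from-to g (to h a))) (from-to h a)
    ; to-mono = λ a b → Function.Bundles.mk⇔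
        (λ x → Function.Bundles.Equivalence.to (to-mono g (to h a) (to h b))
                 (Function.Bundles.Equivalence.to (to-mono h a b) x))
        (λ x → Function.Bundles.Equivalence.from (to-mono h a b)
                 (Function.Bundles.Equivalence.from (to-mono g (to h a) (to h b)) x)) }

  data M0pt : Set where
    inA : A → M0pt
    inR : ℕ → M0pt
    inS : ℕ → M0pt
    inT : (a : A) → p a ≡ inc → M0pt

  _<₀_ : M0pt → M0pt → Set
  inA a <₀ inA b = a <A b
  inA a <₀ inR i = p a ≡ lo          -- type p : U_p below
  inR i <₀ inA a = p a ≡ hi          -- W_p above
  inA a <₀ inS j = p a ≡ inc         -- type q : U_q = V_p
  inS j <₀ inA a = ⊥                 -- W_q = ∅
  inR i <₀ inS j = j N.≤ i
  inA b <₀ inT a _ = p b ≡ inc × b ≤A a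
  _ <₀ _ = ⊥

  act₀ : Aut → M0pt → M0pt
  act₀ g (inA a) = inA (to g a)
  act₀ g (inR i) = inR i
  act₀ g (inS j) = inS j
  act₀ g (inT a e) = inT (to g a) (trans (p-fixed' g a) e)

-- Acceptable chains (M₀ , … , M_K), all realised inside X = M_K;
-- M_j = { x : stage x ≤ j }.

module Chains (st : Setting) where
  open Setting st

  record Chain (K : ℕ) : Set₂ where
    field
      X   : Set
      _<_ : X → X → Set
      X-spo : IsStrictPartialOrder _≡_ _<_
      act : Aut → X → X
      act-id   : ∀ x → act idAut x ≡ x
      act-comp : ∀ g h x → act (g ∘A h) x ≡ act g (act h x)
      act-mono : ∀ g x y → x < y ⇔ act g x < act g y
      stage : X → ℕ
      stage≤K : ∀ x → stage x N.≤ K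
      act-stage : ∀ g x → stage (act g x) ≡ stage x
      emb : M0pt → X
      emb-inj : ∀ y z → emb y ≡ emb z → y ≡ z
      emb-stage : ∀ y → stage (emb y) ≡ 0
      emb-onto : ∀ x → stage x ≡ 0 → ∃[ y ] emb y ≡ x
      emb-order : ∀ y z → emb y < emb z ⇔ y <₀ z
      emb-act : ∀ g y → act g (emb y) ≡ emb (act₀ g y)

    _≤_ : X → X → Set
    x ≤ y = x < y ⊎ x ≡ y

    sPt : ℕ → X
    sPt j = emb (inS j)

    isS : X → Set
    isS x = ∃[ j ] x ≡ sPt j

    isRT : X → Set
    isRT x = (∃[ i ] x ≡ emb (inR i)) ⊎ (∃[ a ] ∃[ e ] x ≡ emb (inT a e))

    Down : (X → Set) → (X → Set) → X → Set
    Down B Y x = B x × ∃[ y ] (Y y × x ≤ y)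

    Up : (X → Set) → (X → Set) → X → Set
    Up B Y x = B x × ∃[ y ] (Y y × y ≤ x)

    downS : X → SubS
    downS m j = sPt j ≤ m

    upS : X → SubS
    upS m j = m ≤ sPt j

    Acceptable : (X → Set) → (X → Set) → (X → Set) → Set₁
    Acceptable B U W =
        (∀ x → U x → B x) × (∀ x → W x → B x)
      × (∀ u w → U u → W w → u < w)
      × (∃[ L ] (∀ x → U x → ¬ isS x → x ∈ L))
      × (∃[ L ] (∀ x → W x → ¬ isS x → x ∈ L))
      × ((∃[ j ] Down B U (sPt j)) →
           ((λ j → Down B U (sPt j)) ∈Fam Σ₁)
           × (∀ m → B m → ¬ ((λ j → Down B U (sPt j)) ≐ downS m)))
      × ((¬ (∃[ x ] (Down B U x × isRT x))) →
           ((λ j → Up B W (sPt j)) ∈Fam Σ₂) ⊎ (∀ j → Up B W (sPt j)))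

    -- the point n (outside B) has type g · τ_B(U , W) over B
    HasType : (X → Set) → (X → Set) → (X → Set) → Aut → X → Set
    HasType B U W g n = ∀ b → B b →
        (b < n ⇔ (∃[ u ] (Down B U u × act g u ≡ b)))
      × (n < b ⇔ (∃[ w ] (Up B W w × act g w ≡ b)))

    StepOK : ℕ → (X → Set) → (X → Set) → Set₁
    StepOK j U W =
      let B : X → Set
          B x = stage x N.< j
          N : X → Set
          N x = stage x ≡ j
      in Acceptable B U W
       × (∀ n → N n → ∃[ g ] HasType B U W g n)
       × (∀ g → ∃[ n ] (N n × HasType B U W g n))
       × (∀ n n' → N n → N n' →
            (∀ b → B b → (b < n ⇔ b < n') × (n < b ⇔ n' < b)) → n ≡ n')
       × (∀ n n' → N n → N n' → (n < n' ⇔ (∃[ b ] (B b × n < b × b < n'))))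

    field
      Uₛ Wₛ : ℕ → X → Set
      steps : ∀ j → 1 N.≤ j → j N.≤ K → StepOK j (Uₛ j) (Wₛ j)

  Conclusion : (K : ℕ) → Chain K → Set₁
  Conclusion K ch =
    (∀ m →
       (∃[ A₀ ] (∀ (g : Aut) → All (λ a → to g a ≡ a) A₀ → act g m ≡ m))
     × ((∃[ j ] m ≤ sPt j) → ¬ isS m →
          ∃[ C ] (All (λ c → p c ≡ inc) C
                 × (∀ a → p a ≡ inc →
                      (emb (inA a) ≤ m ⇔ Any (λ c → emb (inA a) ≤ emb (inA c)) C))))
     × ((¬ (∃[ x ] (isRT x × x ≤ m))) → (upS m ∈Fam Σ₂) ⊎ (∀ j → upS m j))
     × (¬ isS m → (downS m ∈Fam Σ₁) ⊎ (∀ j → ¬ downS m j))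
     × ((∃[ j ] sPt j ≤ m) → ∀ g → ¬ (act g m ≡ m) →
          ¬ (act g m < m) × ¬ (m < act g m))
     × ((∃[ j ] sPt j ≤ m) → ∀ n → ¬ (∃[ g ] act g m ≡ n) →
          ¬ (downS m ≐ downS n)))
    × (∃[ L ] (∀ m → ¬ isS m → Any (λ Y → downS m ≐ Y) L))
    where open Chain ch

-- A point of M_K either lies in M₀ or is new at some stage j ≥ 1; a new point m is h · e for the
-- realisation e of τ(U , W) over M_{j-1}, so its lower and upper sets in M_{j-1} are h[U]⁻ and
-- h[W]⁺. As h fixes S pointwise, m⁻ ∩ S = U⁻ ∩ S and m⁺ ∩ S = W⁺ ∩ S: so (iii) and (iv) come
-- straight from AC4 and AC3, and a non-S point has one of at most K + 1 traces on S. For (i), an automorphism fixing supports of the finitely many non-S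
-- points of h[U ∪ W] fixes h[U] and h[W] pointwise, hence the type of m, hence m, because a new
-- point is determined by its type; (ii) collects finite generating sets of V_p-traces in the same
-- way. For (v), a point strictly between m and g · m would have the same trace on S as m, which
-- AC3 forbids. For (vi), the new points of a stage form one orbit, AC3 separates traces of points
-- of different stages, and for m = s_k the trace {k} is not a moiety.

module Submission where

open import Defs
open import Level using (0ℓ; Lift; lift; lower) renaming (suc to lsuc)
open import Data.Nat using (ℕ; zero; suc)
open import Axiom.ExcludedMiddle using (ExcludedMiddle)
import Data.Nat as N
import Data.Nat.Properties as NP
open import Data.Nat.Induction using (<-wellFounded)
open import Data.Product using (∃-syntax; _×_; _,_; proj₁; proj₂)
open import Data.Sum using (_⊎_; inj₁; inj₂)
import Data.Sum as Sum
open import Data.Sum.Function.Propositional using (_⊎-⇔_)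
open import Data.Empty using (⊥; ⊥-elim)
open import Data.List using (List; []; _∷_; _++_; map; filter; upTo)
open import Data.List.Relation.Unary.All using (All; []; _∷_)
import Data.List.Relation.Unary.All as All
import Data.List.Relation.Unary.All.Properties as AllP
open import Data.List.Relation.Unary.Any using (Any; here; there)
open import Data.List.Relation.Unary.Any.Properties using (++↔; ∷↔)
open import Data.List.Membership.Propositional using (_∈_; find; lose)
open import Data.List.Membership.Propositional.Properties
  using (∈-++⁺ˡ; ∈-++⁺ʳ; ∈-map⁺; ∈-map∘filter⁺; ∈-map∘filter⁻; ∈-upTo⁺)
open import Relation.Nullary using (¬_; Dec; yes; no)
open import Relation.Nullary.Decidable using (map′; toSum)
open import Relation.Binary.PropositionalEquality
  using (_≡_; _≢_; _≗_; refl; sym; trans; cong; subst; subst₂; module ≡-Reasoning)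
open import Relation.Binary.Definitions using (tri<; tri≈; tri>)
open import Relation.Binary.Structures using (IsStrictPartialOrder)
import Relation.Binary.Construct.StrictToNonStrict as NonStrict
import Relation.Binary.Construct.On as On
import Induction.WellFounded as WF
open import Axiom.UniquenessOfIdentityProofs.WithK using (uip)
open import Function using (_∘_; id)
open import Function.Bundles using (_⇔_; mk⇔; module Equivalence)
open import Function.Properties.Inverse using (↔⇒⇔)
open import Function.Construct.Symmetry using (⇔-sym)
open import Function.Construct.Composition using (_⇔-∘_)

module ⇔ = Equivalence

≐-sym : ∀ {Z Y} → Z ≐ Y → Y ≐ Z
≐-sym Z≐Y j = ⇔-sym (Z≐Y j)

≐-trans : ∀ {Z Y V} → Z ≐ Y → Y ≐ V → Z ≐ V
≐-trans Z≐Y Y≐V j = Y≐V j ⇔-∘ Z≐Y j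

∈Fam-resp : ∀ {F Y Y′} → Y ≐ Y′ → Y ∈Fam F → Y′ ∈Fam F
∈Fam-resp Y≐Y′ (Z , FZ , Z≐Y) = Z , FZ , ≐-trans Z≐Y Y≐Y′

module AcceptableChain {st : Setting} {K : ℕ} (ch : Chains.Chain st K) where
  open Setting st
  open Chains st
  open Chain ch
  open IsStrictPartialOrder X-spo using (<-resp-≈) renaming (trans to <-trans)

  ≤-<-trans : ∀ {x y z} → x ≤ y → y < z → x < z
  ≤-<-trans = NonStrict.≤-<-trans _≡_ _<_ sym <-trans (proj₂ <-resp-≈)

  stage-rec : ∀ {ℓ} (P : X → Set ℓ) → (∀ x → (∀ {y} → stage y N.< stage x → P y) → P x) → ∀ x → P x
  stage-rec P = WF.All.wfRec (On.wellFounded stage <-wellFounded) _ P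

  InS⁻ InS⁺ : X → Set
  InS⁻ m = ∃[ j ] m ≤ sPt j
  InS⁺ m = ∃[ j ] sPt j ≤ m

  Below : ℕ → X → Set
  Below j x = stage x N.< j

  _⁻¹ : Aut → Aut
  g ⁻¹ = record
    { to = from g ; from = to g ; to-from = from-to g ; from-to = to-from g
    ; to-mono = λ a b → ⇔-sym (subst₂ (λ a′ b′ → (from g a <A from g b) ⇔ (a′ <A b′))
                                      (to-from g a) (to-from g b) (to-mono g (from g a) (from g b))) }

  inT-cong : ∀ {a a′} → a ≡ a′ → {e : p a ≡ inc} {e′ : p a′ ≡ inc} → inT a e ≡ inT a′ e′
  inT-cong refl {e} {e′} = cong (inT _) (uip e e′)

  act₀-ext : ∀ {g g′} → to g ≗ to g′ → ∀ y → act₀ g y ≡ act₀ g′ y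
  act₀-ext g≗g′ (inA a) = cong inA (g≗g′ a)
  act₀-ext g≗g′ (inR i) = refl
  act₀-ext g≗g′ (inS j) = refl
  act₀-ext g≗g′ (inT a _) = inT-cong (g≗g′ a)

  M₀-or-new : ∀ x → (∃[ y ] emb y ≡ x) ⊎ 1 N.≤ stage x
  M₀-or-new x with stage x in eq
  ... | zero  = inj₁ (emb-onto x eq)
  ... | suc _ = inj₂ (N.s≤s N.z≤n)

  emb≢new : ∀ {y x} → 1 N.≤ stage x → emb y ≢ x
  emb≢new {y} new refl = NP.<⇒≢ new (sym (emb-stage y))

  ≤new⇒< : ∀ {y x} → 1 N.≤ stage x → emb y ≤ x → emb y < x
  ≤new⇒< new = Sum.[ id , ⊥-elim ∘ emb≢new new ]

  new≤⇒< : ∀ {y x} → 1 N.≤ stage x → x ≤ emb y → x < emb y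
  new≤⇒< new = Sum.[ id , ⊥-elim ∘ emb≢new new ∘ sym ]

  sPt-maximal₀ : ∀ k y → ¬ (sPt k < emb y)
  sPt-maximal₀ k (inA a)   s<y = ⇔.to (emb-order _ _) s<y
  sPt-maximal₀ k (inR i)   s<y = ⇔.to (emb-order _ _) s<y
  sPt-maximal₀ k (inS j)   s<y = ⇔.to (emb-order _ _) s<y
  sPt-maximal₀ k (inT a _) s<y = ⇔.to (emb-order _ _) s<y

  sPt≤emb⇒≡ : ∀ {k y} → sPt k ≤ emb y → y ≡ inS k
  sPt≤emb⇒≡ {k} {y} = Sum.[ ⊥-elim ∘ sPt-maximal₀ k y , sym ∘ emb-inj _ _ ]

  emb≤emb⇒≤₀ : ∀ {y z} → emb y ≤ emb z → y <₀ z ⊎ y ≡ z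
  emb≤emb⇒≤₀ = Sum.map (⇔.to (emb-order _ _)) (emb-inj _ _)

  sPt≤sPt⇒≡ : ∀ {k′ k} → sPt k′ ≤ sPt k → k′ ≡ k
  sPt≤sPt⇒≡ s≤s with sPt≤emb⇒≡ s≤s
  ... | refl = refl

  downS-M₀ : ∀ y → ¬ isS (emb y) → ∀ k → ¬ downS (emb y) k
  downS-M₀ y ¬S k s≤y = ¬S (k , cong emb (sPt≤emb⇒≡ s≤y))

  r<s : ∀ {i k} → k N.≤ i → emb (inR i) < sPt k
  r<s = ⇔.from (emb-order _ _)

  M₀-Below : ∀ {j} y → 1 N.≤ j → Below j (emb y)
  M₀-Below {j} y = subst (N._< j) (sym (emb-stage y))

  act-sPt : ∀ g k → act g (sPt k) ≡ sPt k
  act-sPt g k = emb-act g (inS k)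

  act-< : ∀ g {x y} → x < y → act g x < act g y
  act-< g = ⇔.to (act-mono g _ _)

  act-≤ : ∀ g {x y} → x ≤ y → act g x ≤ act g y
  act-≤ g = Sum.map (act-< g) (cong (act g))

  act-Below : ∀ g {j x} → Below j x → Below j (act g x)
  act-Below g {j} {x} = subst (N._< j) (sym (act-stage g x))

  act-<ˡ : ∀ g {b c} x → act g c ≡ b → (b < act g x ⇔ c < x)
  act-<ˡ g x refl = ⇔-sym (act-mono g _ x)

  act-<ʳ : ∀ g {b c} x → act g c ≡ b → (act g x < b ⇔ x < c)
  act-<ʳ g x refl = ⇔-sym (act-mono g x _)

  ActExt : X → Set
  ActExt x = ∀ {g g′} → to g ≗ to g′ → act g x ≡ act g′ x

  act-cancel-at : ∀ {x g h} → ActExt x → to h ∘ to g ≗ id → act h (act g x) ≡ x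
  act-cancel-at {x} {g} {h} ext hg≗id = begin
    act h (act g x)   ≡⟨ act-comp h g x ⟨
    act (h ∘A g) x    ≡⟨ ext hg≗id ⟩
    act idAut x       ≡⟨ act-id x ⟩
    x                 ∎
    where open ≡-Reasoning

  Image : Aut → (X → Set) → X → Set
  Image g D b = ∃[ u ] (D u × act g u ≡ b)

  U⁻∩S W⁺∩S : ℕ → SubS
  U⁻∩S j k = Down (Below j) (Uₛ j) (sPt k)
  W⁺∩S j k = Up (Below j) (Wₛ j) (sPt k)

  module Step {j : ℕ} (1≤j : 1 N.≤ j) (j≤K : j N.≤ K) where
    B : X → Set
    B = Below j

    U W U⁻ W⁺ : X → Set
    U = Uₛ j
    W = Wₛ j
    U⁻ = Down B U
    W⁺ = Up B W

    private
      step : StepOK j U W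
      step = steps j 1≤j j≤K

      acceptable : Acceptable B U W
      acceptable = proj₁ step

    U⊆B : ∀ x → U x → B x
    U⊆B = proj₁ acceptable

    W⊆B : ∀ x → W x → B x
    W⊆B = proj₁ (proj₂ acceptable)

    U-finite-off-S : ∃[ L ] (∀ x → U x → ¬ isS x → x ∈ L)
    U-finite-off-S = proj₁ (proj₂ (proj₂ (proj₂ acceptable)))

    W-finite-off-S : ∃[ L ] (∀ x → W x → ¬ isS x → x ∈ L)
    W-finite-off-S = proj₁ (proj₂ (proj₂ (proj₂ (proj₂ acceptable))))

    AC3 : (∃[ k ] U⁻∩S j k) → (U⁻∩S j ∈Fam Σ₁) × (∀ m → B m → ¬ (U⁻∩S j ≐ downS m))
    AC3 = proj₁ (proj₂ (proj₂ (proj₂ (proj₂ (proj₂ acceptable)))))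

    AC4 : ¬ (∃[ x ] (U⁻ x × isRT x)) → (W⁺∩S j ∈Fam Σ₂) ⊎ (∀ k → W⁺∩S j k)
    AC4 = proj₂ (proj₂ (proj₂ (proj₂ (proj₂ (proj₂ acceptable)))))

    realised : ∀ n → stage n ≡ j → ∃[ g ] HasType B U W g n
    realised = proj₁ (proj₂ step)

    type-determines : ∀ {n n′} → stage n ≡ j → stage n′ ≡ j →
      (∀ b → B b → (b < n ⇔ b < n′) × (n < b ⇔ n′ < b)) → n ≡ n′
    type-determines = proj₁ (proj₂ (proj₂ (proj₂ step))) _ _

    new-order : ∀ {n n′} → stage n ≡ j → stage n′ ≡ j → n < n′ → ∃[ b ] (B b × n < b × b < n′)
    new-order {n} {n′} sn sn′ = ⇔.to (proj₂ (proj₂ (proj₂ (proj₂ step))) n n′ sn sn′)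

    HasType-unique : ∀ {n n′ g g′} → stage n ≡ j → stage n′ ≡ j →
      HasType B U W g n → HasType B U W g′ n′ →
      (∀ b → B b → Image g U⁻ b ⇔ Image g′ U⁻ b) → (∀ b → B b → Image g W⁺ b ⇔ Image g′ W⁺ b) → n ≡ n′
    HasType-unique sn sn′ type type′ same⁻ same⁺ = type-determines sn sn′ λ b Bb →
        (⇔-sym (proj₁ (type′ b Bb)) ⇔-∘ same⁻ b Bb) ⇔-∘ proj₁ (type b Bb)
      , (⇔-sym (proj₂ (type′ b Bb)) ⇔-∘ same⁺ b Bb) ⇔-∘ proj₂ (type b Bb)

  -- Automorphisms are records carrying proofs, so this is not automatic: it holds because a new
  -- point is determined by its type, which only involves the action on earlier stages.
  act-ext : ∀ x → ActExt x
  act-ext = stage-rec ActExt step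
    where
    step : ∀ x → (∀ {y} → stage y N.< stage x → ActExt y) → ActExt x
    step x ih {g} {g′} g≗g′ with M₀-or-new x
    ... | inj₁ (y , refl) = begin
      act g (emb y)    ≡⟨ emb-act g y ⟩
      emb (act₀ g y)   ≡⟨ cong emb (act₀-ext g≗g′ y) ⟩
      emb (act₀ g′ y)  ≡⟨ emb-act g′ y ⟨
      act g′ (emb y)   ∎
      where open ≡-Reasoning
    ... | inj₂ new = type-determines (act-stage g x) (act-stage g′ x) λ b b<x →
      let c = act (g ⁻¹) b
          c<x : stage c N.< stage x
          c<x = act-Below (g ⁻¹) b<x
          gc≡b : act g c ≡ b
          gc≡b = act-cancel-at (ih b<x) (to-from g)
          g′c≡b : act g′ c ≡ b
          g′c≡b = trans (sym (ih c<x g≗g′)) gc≡b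
      in  ⇔-sym (act-<ˡ g′ x g′c≡b) ⇔-∘ act-<ˡ g x gc≡b
        , ⇔-sym (act-<ʳ g′ x g′c≡b) ⇔-∘ act-<ʳ g x gc≡b
      where open Step new (stage≤K x)

  act-cancel : ∀ {g h} x → to h ∘ to g ≗ id → act h (act g x) ≡ x
  act-cancel x = act-cancel-at (act-ext x)

  act-inverseʳ : ∀ g x → act g (act (g ⁻¹) x) ≡ x
  act-inverseʳ g x = act-cancel x (to-from g)

  act-inverseˡ : ∀ g x → act (g ⁻¹) (act g x) ≡ x
  act-inverseˡ g x = act-cancel x (from-to g)

  act-≡-sPt : ∀ g {u k} → act g u ≡ sPt k → u ≡ sPt k
  act-≡-sPt g {u} {k} gu≡s = begin
    u                        ≡⟨ act-inverseˡ g u ⟨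
    act (g ⁻¹) (act g u)     ≡⟨ cong (act (g ⁻¹)) gu≡s ⟩
    act (g ⁻¹) (sPt k)       ≡⟨ act-sPt (g ⁻¹) k ⟩
    sPt k                    ∎
    where open ≡-Reasoning

  act-isS : ∀ g {x} → isS x → act g x ≡ x
  act-isS g (k , refl) = act-sPt g k

  act-¬isS : ∀ g {x} → ¬ isS x → ¬ isS (act g x)
  act-¬isS g ¬S (k , gx≡s) = ¬S (k , act-≡-sPt g gx≡s)

  act-isRT : ∀ g {x} → isRT x → isRT (act g x)
  act-isRT g (inj₁ (i , refl))     = inj₁ (i , emb-act g (inR i))
  act-isRT g (inj₂ (a , e , refl)) = inj₂ (to g a , _ , emb-act g (inT a e))

  Image-ext : ∀ {g g′ D b} → to g ≗ to g′ → Image g D b ⇔ Image g′ D b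
  Image-ext {g} {g′} g≗g′ = mk⇔
    (λ (u , Du , gu≡b) → u , Du , trans (sym (act-ext u g≗g′)) gu≡b)
    (λ (u , Du , g′u≡b) → u , Du , trans (act-ext u g≗g′) g′u≡b)

  Image-fixed : ∀ {g h D b} → (∀ y → D y → act g (act h y) ≡ act h y) → Image (g ∘A h) D b ⇔ Image h D b
  Image-fixed {g} {h} fixed = mk⇔
    (λ (y , Dy , ghy≡b) → y , Dy , trans (sym (fixed y Dy)) (trans (sym (act-comp g h y)) ghy≡b))
    (λ (y , Dy , hy≡b) → y , Dy , trans (act-comp g h y) (trans (fixed y Dy) hy≡b))

  Image-translate : ∀ g {h D b} → Image h D (act (g ⁻¹) b) ⇔ Image (g ∘A h) D b
  Image-translate g {h} {b = b} = mk⇔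
    (λ (u , Du , hu≡c) → u , Du , trans (act-comp g h u) (trans (cong (act g) hu≡c) (act-inverseʳ g b)))
    (λ (u , Du , ghu≡b) → u , Du , trans (sym (act-inverseˡ g (act h u)))
                                         (cong (act (g ⁻¹)) (trans (sym (act-comp g h u)) ghu≡b)))

  Image-sPt : ∀ {g D k} → Image g D (sPt k) ⇔ D (sPt k)
  Image-sPt {g} {D} {k} = mk⇔
    (λ (u , Du , gu≡s) → subst D (act-≡-sPt g gu≡s) Du)
    (λ Ds → sPt k , Ds , act-sPt g k)

  Down-cong : ∀ {B P Q b} → (∀ x → P x ⇔ Q x) → Down B P b ⇔ Down B Q b
  Down-cong P⇔Q = mk⇔ (λ (Bb , y , Py , b≤y) → Bb , y , ⇔.to (P⇔Q y) Py , b≤y)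
                      (λ (Bb , y , Qy , b≤y) → Bb , y , ⇔.from (P⇔Q y) Qy , b≤y)

  Up-cong : ∀ {B P Q b} → (∀ x → P x ⇔ Q x) → Up B P b ⇔ Up B Q b
  Up-cong P⇔Q = mk⇔ (λ (Bb , y , Py , y≤b) → Bb , y , ⇔.to (P⇔Q y) Py , y≤b)
                    (λ (Bb , y , Qy , y≤b) → Bb , y , ⇔.from (P⇔Q y) Qy , y≤b)

  Image-Down : ∀ {g j P b} → Image g (Down (Below j) P) b ⇔ Down (Below j) (Image g P) b
  Image-Down {g} {b = b} = mk⇔
    (λ { (u , (Bu , y , Py , u≤y) , refl) → act-Below g Bu , act g y , (y , Py , refl) , act-≤ g u≤y })
    (λ { (Bb , _ , (y , Py , refl) , b≤gy) →
         act (g ⁻¹) b ,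
         (act-Below (g ⁻¹) Bb , y , Py , subst (act (g ⁻¹) b ≤_) (act-inverseˡ g y) (act-≤ (g ⁻¹) b≤gy)) ,
         act-inverseʳ g b })

  Image-Up : ∀ {g j P b} → Image g (Up (Below j) P) b ⇔ Up (Below j) (Image g P) b
  Image-Up {g} {b = b} = mk⇔
    (λ { (u , (Bu , y , Py , y≤u) , refl) → act-Below g Bu , act g y , (y , Py , refl) , act-≤ g y≤u })
    (λ { (Bb , _ , (y , Py , refl) , gy≤b) →
         act (g ⁻¹) b ,
         (act-Below (g ⁻¹) Bb , y , Py , subst (_≤ act (g ⁻¹) b) (act-inverseˡ g y) (act-≤ (g ⁻¹) gy≤b)) ,
         act-inverseʳ g b })

  HasType-act : ∀ {j U W h n} g → HasType (Below j) U W h n → HasType (Below j) U W (g ∘A h) (act g n)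
  HasType-act {n = n} g type b Bb =
      (Image-translate g ⇔-∘ proj₁ (type c Bc)) ⇔-∘ act-<ˡ g n (act-inverseʳ g b)
    , (Image-translate g ⇔-∘ proj₂ (type c Bc)) ⇔-∘ act-<ʳ g n (act-inverseʳ g b)
    where
    c : X
    c = act (g ⁻¹) b
    Bc : Below _ c
    Bc = act-Below (g ⁻¹) Bb

  module NewPoint {m : X} (new : 1 N.≤ stage m) where
    open Step new (stage≤K m) public

    h : Aut
    h = proj₁ (realised m refl)

    type : HasType B U W h m
    type = proj₂ (realised m refl)

    below⇔ : ∀ {b} → B b → (b < m ⇔ Down B (Image h U) b)
    below⇔ Bb = Image-Down ⇔-∘ proj₁ (type _ Bb)

    U⁻-below : ∀ {u} → U⁻ u → act h u < m
    U⁻-below {u} u∈U⁻ = ⇔.from (proj₁ (type (act h u) (act-Below h (proj₁ u∈U⁻)))) (u , u∈U⁻ , refl)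

    generator-below : ∀ {y} → U y → act h y < m
    generator-below {y} Uy = U⁻-below (U⊆B y Uy , y , Uy , inj₂ refl)

    downS≐ : downS m ≐ U⁻∩S (stage m)
    downS≐ k = Image-sPt ⇔-∘ (proj₁ (type (sPt k) (M₀-Below (inS k) new)) ⇔-∘ mk⇔ (≤new⇒< new) inj₁)

    upS≐ : upS m ≐ W⁺∩S (stage m)
    upS≐ k = Image-sPt ⇔-∘ (proj₂ (type (sPt k) (M₀-Below (inS k) new)) ⇔-∘ mk⇔ (new≤⇒< new) inj₁)

    fixing-generators-fixes : ∀ g → (∀ y → U y → act g (act h y) ≡ act h y) →
      (∀ y → W y → act g (act h y) ≡ act h y) → act g m ≡ m
    fixing-generators-fixes g fixU fixW = HasType-unique (act-stage g m) refl (HasType-act g type) type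
      (λ _ _ → ⇔-sym Image-Down ⇔-∘ (Down-cong {B = B} (λ _ → Image-fixed fixU) ⇔-∘ Image-Down))
      (λ _ _ → ⇔-sym Image-Up ⇔-∘ (Up-cong {B = B} (λ _ → Image-fixed fixW) ⇔-∘ Image-Up))

  new-points-one-orbit : ∀ {m n} → 1 N.≤ stage m → stage n ≡ stage m → ∃[ g ] act g m ≡ n
  new-points-one-orbit {m} {n} new sn =
    g , HasType-unique (act-stage g m) sn (HasType-act g type) type′
          (λ _ _ → Image-ext gh≗h′) (λ _ _ → Image-ext gh≗h′)
    where
    open NewPoint new
    h′ : Aut
    h′ = proj₁ (realised n sn)
    type′ : HasType B U W h′ n
    type′ = proj₂ (realised n sn)
    g : Aut
    g = h′ ∘A (h ⁻¹)
    gh≗h′ : to (g ∘A h) ≗ to h′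
    gh≗h′ a = cong (to h′) (from-to h a)

  A-below-all-S : ∀ a → ¬ (∃[ x ] (isRT x × x ≤ emb (inA a))) → ∀ k → upS (emb (inA a)) k
  A-below-all-S a noRT k with p a in pa
  ... | lo  = ⊥-elim (proj₂ p-lambda a pa)
  ... | inc = inj₁ (⇔.from (emb-order (inA a) (inS k)) pa)
  ... | hi  = ⊥-elim (noRT (emb (inR 0) , inj₁ (0 , refl) , inj₁ (⇔.from (emb-order (inR 0) (inA a)) pa)))

  new-upS-in-Σ₂ : ∀ {m} → 1 N.≤ stage m → ¬ (∃[ x ] (isRT x × x ≤ m)) → (upS m ∈Fam Σ₂) ⊎ (∀ k → upS m k)
  new-upS-in-Σ₂ new noRT =
    Sum.map (∈Fam-resp (≐-sym upS≐)) (λ all k → ⇔.from (upS≐ k) (all k))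
            (AC4 λ (x , x∈U⁻ , RT) → noRT (act h x , act-isRT h RT , inj₁ (U⁻-below x∈U⁻)))
    where open NewPoint new

  upS-in-Σ₂ : ∀ m → ¬ (∃[ x ] (isRT x × x ≤ m)) → (upS m ∈Fam Σ₂) ⊎ (∀ k → upS m k)
  upS-in-Σ₂ m noRT with M₀-or-new m
  ... | inj₁ (inA a , refl)   = inj₂ (A-below-all-S a noRT)
  ... | inj₁ (inR i , refl)   = ⊥-elim (noRT (_ , inj₁ (i , refl) , inj₂ refl))
  ... | inj₁ (inS k , refl)   = ⊥-elim (noRT (emb (inR k) , inj₁ (k , refl) , inj₁ (r<s NP.≤-refl)))
  ... | inj₁ (inT a e , refl) = ⊥-elim (noRT (_ , inj₂ (a , e , refl) , inj₂ refl))
  ... | inj₂ new              = new-upS-in-Σ₂ new noRT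

  -- A point b of an earlier stage with m < b < g · m would satisfy b⁻ ∩ S = m⁻ ∩ S = U⁻ ∩ S.
  new-not-below-translate : ∀ {m k} → 1 N.≤ stage m → sPt k ≤ m → ∀ g → ¬ (m < act g m)
  new-not-below-translate {m} {k} new s≤m g m<gm =
    let b , Bb , m<b , b<gm = new-order refl (act-stage g m) m<gm
    in proj₂ (AC3 (k , ⇔.to (downS≐ k) s≤m)) b Bb λ k′ → mk⇔
         (λ s∈U⁻ → inj₁ (≤-<-trans (⇔.from (downS≐ k′) s∈U⁻) m<b))
         (λ s≤b → ⇔.to (downS≐ k′) (inj₁ (⇔.to (act-<ˡ g m (act-sPt g k′)) (≤-<-trans s≤b b<gm))))
    where open NewPoint new

  S⁺-orbit-antichain : ∀ m → InS⁺ m → ∀ g → act g m ≢ m → ¬ (act g m < m) × ¬ (m < act g m)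
  S⁺-orbit-antichain m (k , s≤m) g moved with M₀-or-new m
  ... | inj₁ (y , refl) with sPt≤emb⇒≡ s≤m
  ...   | refl = ⊥-elim (moved (act-sPt g k))
  S⁺-orbit-antichain m (k , s≤m) g moved | inj₂ new =
      (λ gm<m → new-not-below-translate new s≤m (g ⁻¹) (⇔.to (act-<ʳ g m (act-inverseʳ g m)) gm<m))
    , new-not-below-translate new s≤m g

  new-downS-fresh : ∀ {n m k} → 1 N.≤ stage n → stage m N.< stage n → sPt k ≤ n → ¬ (downS n ≐ downS m)
  new-downS-fresh {m = m} {k} new m<n s≤n n≐m =
    proj₂ (AC3 (k , ⇔.to (downS≐ k) s≤n)) m m<n (≐-trans (≐-sym downS≐) n≐m)
    where open NewPoint new

  new-downS-unbounded : ∀ {n k} → 1 N.≤ stage n → sPt k ≤ n → ∀ i → ∃[ k′ ] (i N.≤ k′ × sPt k′ ≤ n)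
  new-downS-unbounded {k = k} new s≤n i =
    let Z , ΣZ , Z≐ = proj₁ (AC3 (k , ⇔.to (downS≐ k) s≤n))
        k′ , i≤k′ , Zk′ = proj₁ (Σ₁-moieties Z ΣZ) i
    in  k′ , i≤k′ , ⇔.from (downS≐ k′) (⇔.to (Z≐ k′) Zk′)
    where open NewPoint new

  sPt-downS-unique : ∀ k {n} → downS n ≐ downS (sPt k) → n ≡ sPt k
  sPt-downS-unique k {n} n≐s with M₀-or-new n
  ... | inj₁ (y , refl) = cong emb (sPt≤emb⇒≡ (⇔.from (n≐s k) (inj₂ refl)))
  ... | inj₂ new =
    let k′ , k<k′ , s′≤n = new-downS-unbounded new (⇔.from (n≐s k) (inj₂ refl)) (suc k)
    in  ⊥-elim (NP.<⇒≢ k<k′ (sym (sPt≤sPt⇒≡ (⇔.to (n≐s k′) s′≤n))))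

  S⁺-downS-separates-orbits : ∀ m → InS⁺ m → ∀ n → ¬ (∃[ g ] act g m ≡ n) → ¬ (downS m ≐ downS n)
  S⁺-downS-separates-orbits m (k , s≤m) n not-orbit m≐n with M₀-or-new m
  ... | inj₁ (y , refl) with sPt≤emb⇒≡ s≤m
  ...   | refl = not-orbit (idAut , trans (act-id _) (sym (sPt-downS-unique k (≐-sym m≐n))))
  S⁺-downS-separates-orbits m (k , s≤m) n not-orbit m≐n | inj₂ new with NP.<-cmp (stage n) (stage m)
  ... | tri< n<m _ _ = new-downS-fresh new n<m s≤m m≐n
  ... | tri≈ _ sn _  = not-orbit (new-points-one-orbit new sn)
  ... | tri> _ _ m<n = new-downS-fresh (NP.≤-trans new (NP.<⇒≤ m<n)) m<n (⇔.to (m≐n k) s≤m) (≐-sym m≐n)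

  downS-finitely-many : ∃[ L ] (∀ m → ¬ isS m → Any (λ Y → downS m ≐ Y) L)
  downS-finitely-many = (λ _ → ⊥) ∷ map U⁻∩S (upTo (suc K)) , listed
    where
    listed : ∀ m → ¬ isS m → Any (downS m ≐_) ((λ _ → ⊥) ∷ map U⁻∩S (upTo (suc K)))
    listed m ¬S with M₀-or-new m
    ... | inj₁ (y , refl) = here λ k → mk⇔ (downS-M₀ y ¬S k) ⊥-elim
    ... | inj₂ new = there (lose (∈-map⁺ U⁻∩S (∈-upTo⁺ (N.s≤s (stage≤K m)))) (NewPoint.downS≐ new))

  Supports : List A → X → Set
  Supports A₀ x = ∀ (g : Aut) → All (λ a → to g a ≡ a) A₀ → act g x ≡ x

  Supported : X → Set
  Supported x = ∃[ A₀ ] Supports A₀ x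

  common-support : (L : List X) → All Supported L → ∃[ A₀ ] All (Supports A₀) L
  common-support []      []                    = [] , []
  common-support (x ∷ L) ((A₀ , supp) ∷ supps) =
    let A₁ , supps′ = common-support L supps
    in  A₀ ++ A₁
      , (λ g fix → supp g (AllP.++⁻ˡ A₀ fix))
      ∷ All.map (λ supp′ g fix → supp′ g (AllP.++⁻ʳ A₀ fix)) supps′

  support₀ : M0pt → List A
  support₀ (inA a)   = a ∷ []
  support₀ (inR _)   = []
  support₀ (inS _)   = []
  support₀ (inT a _) = a ∷ []

  act₀-fixes : ∀ g y → All (λ a → to g a ≡ a) (support₀ y) → act₀ g y ≡ y
  act₀-fixes g (inA a)   (ga≡a ∷ []) = cong inA ga≡a
  act₀-fixes g (inR _)   []          = refl
  act₀-fixes g (inS _)   []          = refl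
  act₀-fixes g (inT a _) (ga≡a ∷ []) = inT-cong ga≡a

  M₀-supported : ∀ y → Supported (emb y)
  M₀-supported y = support₀ y , λ g fix → trans (emb-act g y) (cong emb (act₀-fixes g y fix))

  VpGeneratedBy : List A → (X → Set) → Set
  VpGeneratedBy C D = All (λ c → p c ≡ inc) C ×
    (∀ a → p a ≡ inc → (D (emb (inA a)) ⇔ Any (λ c → emb (inA a) ≤ emb (inA c)) C))

  VpFinitelyGenerated : (X → Set) → Set
  VpFinitelyGenerated D = ∃[ C ] VpGeneratedBy C D

  VpFinitelyGenerated-resp : ∀ {D D′} → (∀ a → p a ≡ inc → D (emb (inA a)) ⇔ D′ (emb (inA a))) →
    VpFinitelyGenerated D′ → VpFinitelyGenerated D
  VpFinitelyGenerated-resp D⇔D′ (C , Vp-C , gen) = C , Vp-C , λ a pa → gen a pa ⇔-∘ D⇔D′ a pa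

  VpFinitelyGenerated-⋃ : (L : List X) → All (λ x → VpFinitelyGenerated (_≤ x)) L →
    VpFinitelyGenerated (λ z → Any (z ≤_) L)
  VpFinitelyGenerated-⋃ []      []                      = [] , [] , λ _ _ → mk⇔ (λ ()) (λ ())
  VpFinitelyGenerated-⋃ (x ∷ L) ((C , Vp-C , gen) ∷ gens) =
    let C′ , Vp-C′ , gen′ = VpFinitelyGenerated-⋃ L gens
    in  C ++ C′ , AllP.++⁺ Vp-C Vp-C′ ,
        λ a pa → (↔⇒⇔ ++↔ ⇔-∘ (gen a pa ⊎-⇔ gen′ a pa)) ⇔-∘ ⇔-sym (↔⇒⇔ (∷↔ _))

  A≤sPt⇒inc : ∀ {a k} → emb (inA a) ≤ sPt k → p a ≡ inc
  A≤sPt⇒inc a≤s with emb≤emb⇒≤₀ a≤s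
  ... | inj₁ pa = pa

  M₀-VpFinitelyGenerated : ∀ y → InS⁻ (emb y) → ¬ isS (emb y) → VpFinitelyGenerated (_≤ emb y)
  M₀-VpFinitelyGenerated (inA a) (k , a≤s) _ =
    a ∷ [] , A≤sPt⇒inc a≤s ∷ [] , λ _ _ → mk⇔ here λ { (here a′≤a) → a′≤a ; (there ()) }
  M₀-VpFinitelyGenerated (inR i) _ _ = [] , [] , λ a pa → mk⇔ (⊥-elim ∘ not-below a pa) λ ()
    where
    not-below : ∀ a → p a ≡ inc → ¬ (emb (inA a) ≤ emb (inR i))
    not-below a pa a≤r with emb≤emb⇒≤₀ a≤r
    ... | inj₁ pa≡lo with trans (sym pa≡lo) pa
    ...   | ()
  M₀-VpFinitelyGenerated (inS k) _ ¬S = ⊥-elim (¬S (k , refl))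
  M₀-VpFinitelyGenerated (inT a e) (k , t≤s) _ with emb≤emb⇒≤₀ t≤s
  ... | inj₁ ()
  ... | inj₂ ()

  module Classical (em : ExcludedMiddle (lsuc 0ℓ)) where
    decide : (P : Set) → Dec P
    decide P = map′ lower lift (em {Lift (lsuc 0ℓ) P})

    new-supported : ∀ {m} → 1 N.≤ stage m → (∀ {y} → stage y N.< stage m → Supported y) → Supported m
    new-supported {m} new ih = A₀ , λ g fix →
      fixing-generators-fixes g
        (fixes g fix U U⊆B λ y Uy ¬S → ∈-++⁺ˡ (proj₂ U-finite-off-S y Uy ¬S))
        (fixes g fix W W⊆B λ y Wy ¬S → ∈-++⁺ʳ (proj₁ U-finite-off-S) (proj₂ W-finite-off-S y Wy ¬S))
      where
      open NewPoint new

      listed : List X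
      listed = proj₁ U-finite-off-S ++ proj₁ W-finite-off-S

      L : List X
      L = map (act h) (filter (λ y → stage y N.<? stage m) listed)

      supported-L : ∀ {x} → x ∈ L → Supported x
      supported-L x∈L with ∈-map∘filter⁻ (act h) (λ y → stage y N.<? stage m) {xs = listed} x∈L
      ... | y , _ , refl , y<m = ih (act-Below h y<m)

      common : ∃[ A₀ ] All (Supports A₀) L
      common = common-support L (All.tabulate supported-L)

      A₀ : List A
      A₀ = proj₁ common

      fixes : ∀ g → All (λ a → to g a ≡ a) A₀ → (V : X → Set) → (∀ y → V y → B y) →
        (∀ y → V y → ¬ isS y → y ∈ listed) → ∀ y → V y → act g (act h y) ≡ act h y
      fixes g fix V V⊆B V-listed y Vy with decide (isS y)
      ... | yes (k , refl) = act-isS g (k , act-sPt h k)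
      ... | no ¬S =
        All.lookup (proj₂ common) (∈-map∘filter⁺ (act h) _ (y , V-listed y Vy ¬S , refl , V⊆B y Vy)) g fix

    supported : ∀ m → Supported m
    supported = stage-rec Supported step
      where
      step : ∀ m → (∀ {y} → stage y N.< stage m → Supported y) → Supported m
      step m ih with M₀-or-new m
      ... | inj₁ (y , refl) = M₀-supported y
      ... | inj₂ new        = new-supported new ih

    new-VpFinitelyGenerated : ∀ {m k} → 1 N.≤ stage m → m < sPt k →
      (∀ {y} → stage y N.< stage m → InS⁻ y → ¬ isS y → VpFinitelyGenerated (_≤ y)) →
      VpFinitelyGenerated (_≤ m)
    new-VpFinitelyGenerated {m} {k} new m<s ih =
      VpFinitelyGenerated-resp {D = _≤ m} {D′ = λ z → Any (z ≤_) L} below⇔listed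
        (VpFinitelyGenerated-⋃ L (All.tabulate generated))
      where
      open NewPoint new

      listed : List X
      listed = proj₁ U-finite-off-S

      L : List X
      L = map (act h) (filter (decide ∘ U) listed)

      generator-off-S : ∀ {y} → U y → ¬ isS y
      generator-off-S Uy (k′ , refl) =
        sPt-maximal₀ k′ (inS k) (<-trans (subst (_< m) (act-sPt h k′) (generator-below Uy)) m<s)

      generated : ∀ {x} → x ∈ L → VpFinitelyGenerated (_≤ x)
      generated x∈L with ∈-map∘filter⁻ (act h) (decide ∘ U) {xs = listed} x∈L
      ... | y , _ , refl , Uy =
        ih (act-Below h (U⊆B y Uy)) (k , inj₁ (<-trans (generator-below Uy) m<s))
           (act-¬isS h (generator-off-S Uy))

      below⇔listed : ∀ a → p a ≡ inc → (emb (inA a) ≤ m ⇔ Any (emb (inA a) ≤_) L)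
      below⇔listed a _ = mk⇔ listed-above unlisted
        where
        listed-above : emb (inA a) ≤ m → Any (emb (inA a) ≤_) L
        listed-above a≤m with ⇔.to (below⇔ (M₀-Below (inA a) new)) (≤new⇒< new a≤m)
        ... | _ , _ , (y , Uy , refl) , a≤hy =
          let y-listed = proj₂ U-finite-off-S y Uy (generator-off-S Uy)
          in  lose (∈-map∘filter⁺ (act h) (decide ∘ U) (y , y-listed , refl , Uy)) a≤hy
        unlisted : Any (emb (inA a) ≤_) L → emb (inA a) ≤ m
        unlisted any with find any
        ... | x , x∈L , a≤x with ∈-map∘filter⁻ (act h) (decide ∘ U) {xs = listed} x∈L
        ...   | y , _ , refl , Uy = inj₁ (≤-<-trans a≤x (generator-below Uy))

    VpFinitelyGenerated-below-S : ∀ m → InS⁻ m → ¬ isS m → VpFinitelyGenerated (_≤ m)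
    VpFinitelyGenerated-below-S = stage-rec _ step
      where
      step : ∀ m → (∀ {y} → stage y N.< stage m → InS⁻ y → ¬ isS y → VpFinitelyGenerated (_≤ y)) →
        InS⁻ m → ¬ isS m → VpFinitelyGenerated (_≤ m)
      step m ih (k , m≤s) ¬S with M₀-or-new m
      ... | inj₁ (y , refl) = M₀-VpFinitelyGenerated y (k , m≤s) ¬S
      ... | inj₂ new        = new-VpFinitelyGenerated new (new≤⇒< new m≤s) ih

    new-downS-in-Σ₁ : ∀ {m} → 1 N.≤ stage m → (downS m ∈Fam Σ₁) ⊎ (∀ k → ¬ downS m k)
    new-downS-in-Σ₁ new =
      Sum.map (λ nonempty → ∈Fam-resp (≐-sym downS≐) (proj₁ (AC3 nonempty)))
              (λ empty k s≤m → empty (k , ⇔.to (downS≐ k) s≤m))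
              (toSum (decide _))
      where open NewPoint new

    downS-in-Σ₁ : ∀ m → ¬ isS m → (downS m ∈Fam Σ₁) ⊎ (∀ k → ¬ downS m k)
    downS-in-Σ₁ m ¬S with M₀-or-new m
    ... | inj₁ (y , refl) = inj₂ (downS-M₀ y ¬S)
    ... | inj₂ new        = new-downS-in-Σ₁ new

lemma5p8 : ExcludedMiddle (lsuc 0ℓ) →
    (st : Setting) (K : ℕ) (ch : Chains.Chain st K) → Chains.Conclusion st K ch
lemma5p8 em st K ch =
    (λ m → supported m , VpFinitelyGenerated-below-S m , upS-in-Σ₂ m , downS-in-Σ₁ m
         , S⁺-orbit-antichain m , S⁺-downS-separates-orbits m)
  , downS-finitely-many
  where
  open AcceptableChain ch
  open Classical em
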